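{- For all $n\geq1$, the number of non-decreasing Dyck paths with air pockets of length $n$ having no valley at positive height equals $F_{n-1}$, where $(F_m)$ is the Fibonacci sequence with $F_0=0$, $F_1=1$, $F_{m}=F_{m-1}+F_{m-2}$.
   Context: A Dyck path with air pockets is a non-empty lattice path in the first quadrant starting at the origin, ending on the $x$-axis, with up-steps $U=(1,1)$ and down-steps $D_k=(1,-k)$, $k\ge1$, no two down-steps consecutive; its length is its number of steps. A valley is an occurrence of a factor $D_kU$ ($k\ge1$), and its height is the ordinate of the point between $D_k$ and $U$. A Dyck path with air pockets is non-decreasing if the heights of its valleys, read from left to right, form a non-decreasing sequence. -}

module Defs where

open import Data.Nat using (ℕ; zero; suc; _+_; _≤_; _≤ᵇ_; _∸_; _≡ᵇ_)
open import Data.Bool using (Bool; true; false; _∧_)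
open import Data.List using (List; []; _∷_; length)
open import Data.List.Relation.Unary.All using (All)
open import Data.List.Relation.Unary.Linked using (Linked)
open import Relation.Binary.PropositionalEquality using (_≡_)

fib : ℕ → ℕ
fib zero = zero
fib (suc zero) = suc zero
fib (suc (suc m)) = fib (suc m) + fib m

-- Steps.  U = (1,1);  D k  denotes the down-step D_{k+1} = (1, -(k+1)),
-- so every down-step has k ≥ 1 by construction.
data Step : Set where
  U : Step
  D : ℕ → Step

drop : ℕ → ℕ
drop k = suc k

-- walk h lastDown s : the rest s of the path, started at height h, where
-- lastDown says whether the previous step was a down-step, stays in the
-- first quadrant, has no two consecutive down-steps and ends on the x-axis.
walk : ℕ → Bool → List Step → Bool
walk h _     []          = h ≡ᵇ 0
walk h _     (U ∷ s)     = walk (suc h) false s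
walk h false (D k ∷ s)   = (drop k ≤ᵇ h) ∧ walk (h ∸ drop k) true s
walk h true  (D k ∷ s)   = false

isDyckAP : List Step → Bool
isDyckAP []      = false
isDyckAP (x ∷ s) = walk 0 false (x ∷ s)

-- Heights of the valleys (occurrences of a factor D_k U), left to right,
-- the height being the ordinate of the point between D_k and U.
valleysFrom : ℕ → List Step → List ℕ
valleysFrom h []                = []
valleysFrom h (U ∷ s)           = valleysFrom (suc h) s
valleysFrom h (D k ∷ [])        = []
valleysFrom h (D k ∷ U ∷ s)     = (h ∸ drop k) ∷ valleysFrom (h ∸ drop k) (U ∷ s)
valleysFrom h (D k ∷ D j ∷ s)   = valleysFrom (h ∸ drop k) (D j ∷ s)

valleyHeights : List Step → List ℕ
valleyHeights = valleysFrom 0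

NonDecreasing : List Step → Set
NonDecreasing p = Linked _≤_ (valleyHeights p)

NoPositiveValley : List Step → Set
NoPositiveValley p = All (_≡ 0) (valleyHeights p)

module Submission where

-- With every valley at height 0, each down-step lands on the x-axis, and since no two down-steps
-- are consecutive such a path is a sequence of pyramids U^(k+1) D_(k+1), k ≥ 0, each of length
-- k + 2; the non-decreasing condition then holds automatically.  So the paths of length n are
-- the compositions of n into parts ≥ 2, and removing a first part 2 or shrinking a larger first
-- part by 1 gives the Fibonacci recurrence c (m + 2) = c (m + 1) + c m.

open import Defs
open import Data.Nat using (ℕ; _≤_; _∸_)
open import Data.Bool using (true)
open import Data.List using (List; length)
open import Data.Product using (Σ; _×_)
open import Data.Fin using (Fin)
open import Function.Bundles using (_↔_)
open import Relation.Binary.PropositionalEquality using (_≡_)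

open import Data.Nat using (zero; suc; _+_; _≤ᵇ_; s≤s⁻¹)
open import Data.Nat.Properties
  using (≤ᵇ⇒≤; ≤⇒≤ᵇ; ≡ᵇ⇒≡; ≤-refl; ≤-antisym; ≤-irrelevant; ≡-irrelevant; n∸n≡0; m∸n≡0⇒m≤n; +-suc; +-identityʳ; suc-injective)
open import Data.Bool using (false; _∧_)
import Data.Bool as Bool
open import Data.Bool.Properties using (T-≡; ∧-conicalˡ; ∧-conicalʳ)
open import Data.List using ([]; _∷_; map)
open import Data.Nat.ListAction using (sum)
open import Data.List.Relation.Unary.All as All using (All; []; _∷_)
open import Data.List.Relation.Unary.Linked as Linked using (Linked; []; [-]; _∷_)
open import Data.Product using (_,_)
open import Data.Sum using (_⊎_; inj₁; inj₂)
open import Data.Sum.Function.Propositional using (_⊎-↔_)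
open import Data.Fin.Properties using (+↔⊎)
open import Function.Bundles using (mk↔ₛ′; Equivalence)
open import Function.Properties.Inverse using (↔-trans; ↔-sym)
open import Axiom.UniquenessOfIdentityProofs using (module Decidable⇒UIP)
open import Relation.Binary.PropositionalEquality using (refl; sym; trans; cong; subst; module ≡-Reasoning)

private
  true-T : ∀ {b} → b ≡ true → Bool.T b
  true-T = Equivalence.from T-≡

ups : ℕ → List Step → List Step
ups zero    r = r
ups (suc j) r = U ∷ ups j r

pyramids : List ℕ → List Step
pyramids []       = []
pyramids (k ∷ ks) = ups (suc k) (D k ∷ pyramids ks)

peaks : List Step → List ℕ
peaks []        = []
peaks (U ∷ s)   = peaks s
peaks (D k ∷ s) = k ∷ peaks s

weight : List ℕ → ℕ
weight ks = sum (map (2 +_) ks)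

ups-U : ∀ j r → ups j (U ∷ r) ≡ U ∷ ups j r
ups-U zero    r = refl
ups-U (suc j) r = cong (U ∷_) (ups-U j r)

walk-ups : ∀ j h r → walk h false (ups j r) ≡ walk (h + j) false r
walk-ups zero    h r = cong (λ x → walk x false r) (sym (+-identityʳ h))
walk-ups (suc j) h r = trans (walk-ups j (suc h) r) (cong (λ x → walk x false r) (sym (+-suc h j)))

valleys-ups : ∀ j h r → valleysFrom h (ups j r) ≡ valleysFrom (h + j) r
valleys-ups zero    h r = cong (λ x → valleysFrom x r) (sym (+-identityʳ h))
valleys-ups (suc j) h r = trans (valleys-ups j (suc h) r) (cong (λ x → valleysFrom x r) (sym (+-suc h j)))

length-ups : ∀ j r → length (ups j r) ≡ j + length r
length-ups zero    r = refl
length-ups (suc j) r = cong suc (length-ups j r)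

peaks-ups : ∀ j r → peaks (ups j r) ≡ peaks r
peaks-ups zero    r = refl
peaks-ups (suc j) r = peaks-ups j r

peaks-pyramids : ∀ ks → peaks (pyramids ks) ≡ ks
peaks-pyramids []       = refl
peaks-pyramids (k ∷ ks) = trans (peaks-ups k _) (cong (k ∷_) (peaks-pyramids ks))

length-pyramids : ∀ ks → length (pyramids ks) ≡ weight ks
length-pyramids []       = refl
length-pyramids (k ∷ ks) = cong suc (begin
  length (ups k (D k ∷ pyramids ks))  ≡⟨ length-ups k _ ⟩
  k + suc (length (pyramids ks))      ≡⟨ +-suc k _ ⟩
  suc (k + length (pyramids ks))      ≡⟨ cong (λ x → suc (k + x)) (length-pyramids ks) ⟩
  suc (k + weight ks)                 ∎)
  where open ≡-Reasoning

walk-summit : ∀ k r → walk (suc k) false (D k ∷ r) ≡ walk 0 true r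
walk-summit k r rewrite n∸n≡0 k = cong (_∧ walk 0 true r) (Equivalence.to T-≡ (≤⇒≤ᵇ (≤-refl {suc k})))

pyramids-walk : ∀ ks b → walk 0 b (pyramids ks) ≡ true
pyramids-walk []       b = refl
pyramids-walk (k ∷ ks) b = begin
  walk 1 false (ups k (D k ∷ pyramids ks))  ≡⟨ walk-ups k 1 _ ⟩
  walk (suc k) false (D k ∷ pyramids ks)    ≡⟨ walk-summit k (pyramids ks) ⟩
  walk 0 true (pyramids ks)                 ≡⟨ pyramids-walk ks true ⟩
  true                                      ∎
  where open ≡-Reasoning

pyramids-isDyckAP : ∀ ks {m} → weight ks ≡ suc m → isDyckAP (pyramids ks) ≡ true
pyramids-isDyckAP (k ∷ ks) _ = pyramids-walk (k ∷ ks) false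

pyramids-valleys : ∀ ks → All (_≡ 0) (valleyHeights (pyramids ks))
pyramids-valleys []       = []
pyramids-valleys (k ∷ ks) rewrite valleys-ups k 1 (D k ∷ pyramids ks) = after-summit ks (pyramids-valleys ks)
  where
  after-summit : ∀ js → All (_≡ 0) (valleyHeights (pyramids js)) →
    All (_≡ 0) (valleysFrom (suc k) (D k ∷ pyramids js))
  after-summit []       _ = []
  after-summit (j ∷ js) v rewrite n∸n≡0 k = refl ∷ v

descent-to-ground : ∀ k a {b} → ((suc k ≤ᵇ suc a) ∧ b) ≡ true → a ∸ k ≡ 0 → k ≡ a
descent-to-ground k a w landing =
  ≤-antisym (s≤s⁻¹ (≤ᵇ⇒≤ (suc k) (suc a) (true-T (∧-conicalˡ _ _ w)))) (m∸n≡0⇒m≤n landing)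

climb-to-summit : ∀ {k a r r′} → k ≡ a → r ≡ r′ → ups (suc a) (D k ∷ r) ≡ ups (suc k) (D k ∷ r′)
climb-to-summit refl refl = refl

-- p is what remains of a path after climbing h up-steps from the x-axis.
grounded⇒pyramids : ∀ h p → walk h false p ≡ true → All (_≡ 0) (valleysFrom h p) →
  ups h p ≡ pyramids (peaks p)
grounded⇒pyramids zero    []              _ _ = refl
grounded⇒pyramids (suc a) []              () _
grounded⇒pyramids h       (U ∷ s)         w v = trans (ups-U h s) (grounded⇒pyramids (suc h) s w v)
grounded⇒pyramids zero    (D k ∷ s)       () _
grounded⇒pyramids (suc a) (D k ∷ [])      w _ =
  climb-to-summit (descent-to-ground k a w (≡ᵇ⇒≡ (a ∸ k) 0 (true-T (∧-conicalʳ (suc k ≤ᵇ suc a) _ w)))) refl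
grounded⇒pyramids (suc a) (D k ∷ D j ∷ s) w _
  with () ← ∧-conicalʳ (suc k ≤ᵇ suc a) false w
grounded⇒pyramids (suc a) (D k ∷ U ∷ t)   w (landing ∷ v) =
  climb-to-summit (descent-to-ground k a w landing) (grounded⇒pyramids 0 (U ∷ t) w′ v′)
  where
  w′ : walk 0 false (U ∷ t) ≡ true
  w′ = subst (λ x → walk x true (U ∷ t) ≡ true) landing (∧-conicalʳ (suc k ≤ᵇ suc a) _ w)
  v′ : All (_≡ 0) (valleysFrom 0 (U ∷ t))
  v′ = subst (λ x → All (_≡ 0) (valleysFrom x (U ∷ t))) landing v

pyramids-peaks : ∀ p → isDyckAP p ≡ true → NoPositiveValley p → pyramids (peaks p) ≡ p
pyramids-peaks (x ∷ s) dyck grounded = sym (grounded⇒pyramids 0 (x ∷ s) dyck grounded)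

constant⇒nonDecreasing : ∀ {c xs} → All (_≡ c) xs → Linked _≤_ xs
constant⇒nonDecreasing []                  = []
constant⇒nonDecreasing (_ ∷ [])            = [-]
constant⇒nonDecreasing (refl ∷ refl ∷ xs)  = ≤-refl ∷ constant⇒nonDecreasing (refl ∷ xs)

Paths : ℕ → Set
Paths n = Σ (List Step) (λ p → (isDyckAP p ≡ true) × (length p ≡ n) × NonDecreasing p × NoPositiveValley p)

-- Compositions of n into parts ≥ 2, a part k + 2 being recorded as k.
Compositions : ℕ → Set
Compositions n = Σ (List ℕ) λ ks → weight ks ≡ n

path-≡ : ∀ {n p q} → p ≡ q → (x : _) (y : _) → _≡_ {A = Paths n} (p , x) (q , y)
path-≡ refl (d , l , nd , v) (d′ , l′ , nd′ , v′)
  rewrite Decidable⇒UIP.≡-irrelevant Bool._≟_ d d′ | ≡-irrelevant l l′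
        | Linked.irrelevant ≤-irrelevant nd nd′ | All.irrelevant ≡-irrelevant v v′ = refl

composition-≡ : ∀ {n ks ks′} → ks ≡ ks′ → (e : weight ks ≡ n) (e′ : weight ks′ ≡ n) →
  _≡_ {A = Compositions n} (ks , e) (ks′ , e′)
composition-≡ refl e e′ = cong (_ ,_) (≡-irrelevant e e′)

paths↔compositions : ∀ m → Paths (suc m) ↔ Compositions (suc m)
paths↔compositions m = mk↔ₛ′ to from to∘from from∘to
  where
  to : Paths (suc m) → Compositions (suc m)
  to (p , dyck , len , _ , grounded) = peaks p ,
    trans (sym (length-pyramids (peaks p))) (trans (cong length (pyramids-peaks p dyck grounded)) len)
  from : Compositions (suc m) → Paths (suc m)
  from (ks , e) = pyramids ks , pyramids-isDyckAP ks e , trans (length-pyramids ks) e ,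
    constant⇒nonDecreasing (pyramids-valleys ks) , pyramids-valleys ks
  to∘from : ∀ c → to (from c) ≡ c
  to∘from (ks , e) = composition-≡ (peaks-pyramids ks) _ e
  from∘to : ∀ x → from (to x) ≡ x
  from∘to (p , dyck , _ , _ , grounded) = path-≡ (pyramids-peaks p dyck grounded) _ _

compositions-0 : Compositions 0 ↔ Fin 1
compositions-0 = mk↔ₛ′ (λ _ → Fin.zero) (λ _ → [] , refl) (λ { Fin.zero → refl ; (Fin.suc ()) })
  (λ { ([] , e) → composition-≡ refl refl e })
  where import Data.Fin as Fin

compositions-1 : Compositions 1 ↔ Fin 0
compositions-1 = mk↔ₛ′ (λ { ([] , ()) }) (λ ()) (λ ()) (λ { ([] , ()) })

compositions-split : ∀ m → Compositions (2 + m) ↔ (Compositions (1 + m) ⊎ Compositions m)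
compositions-split m = mk↔ₛ′ to from to∘from from∘to
  where
  to : Compositions (2 + m) → Compositions (1 + m) ⊎ Compositions m
  to (zero  ∷ ks , e) = inj₂ (ks , suc-injective (suc-injective e))
  to (suc k ∷ ks , e) = inj₁ (k ∷ ks , suc-injective e)
  from : Compositions (1 + m) ⊎ Compositions m → Compositions (2 + m)
  from (inj₁ (k ∷ ks , e)) = suc k ∷ ks , cong suc e
  from (inj₂ (ks , e))     = zero ∷ ks , cong (2 +_) e
  to∘from : ∀ c → to (from c) ≡ c
  to∘from (inj₁ (k ∷ ks , e)) = cong inj₁ (composition-≡ refl _ e)
  to∘from (inj₂ (ks , e))     = cong inj₂ (composition-≡ refl _ e)
  from∘to : ∀ c → from (to c) ≡ c
  from∘to (zero  ∷ ks , e) = composition-≡ refl _ e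
  from∘to (suc k ∷ ks , e) = composition-≡ refl _ e

⊎-↔-Fin : ∀ {a b} {A B : Set} → A ↔ Fin a → B ↔ Fin b → (A ⊎ B) ↔ Fin (a + b)
⊎-↔-Fin f g = ↔-trans (f ⊎-↔ g) (↔-sym +↔⊎)

compositions-count : ∀ m → Compositions (suc m) ↔ Fin (fib m)
compositions-count zero          = compositions-1
compositions-count (suc zero)    = ↔-trans (compositions-split 0) (⊎-↔-Fin compositions-1 compositions-0)
compositions-count (suc (suc m)) =
  ↔-trans (compositions-split (suc m)) (⊎-↔-Fin (compositions-count (suc m)) (compositions-count m))

theorem9 : (n : ℕ) → 1 ≤ n →
    (Σ (List Step) (λ p → (isDyckAP p ≡ true) × (length p ≡ n) × NonDecreasing p × NoPositiveValley p))
      ↔ Fin (fib (n ∸ 1))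
theorem9 (suc m) _ = ↔-trans (paths↔compositions m) (compositions-count m)
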